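{- Let $G=(U,V,E)$ be a bipartite graph, $k\ge 0$ an integer, and $(S,C)$ an instance. Let $u\in C$ satisfy $\overline d_{S\cup C}(u)=1$, and let $C_u$ be the set of vertices of $C$ on the same side as $u$. Let $P=\{v\in C_u\setminus\{u\}:\overline d_S(v)\ge1\}$, and if moreover $\overline d_C(u)=1$ and $w$ is the unique non-neighbor of $u$ in $C$, enlarge $P$ to $P\cup\overline N_C(w)$. Then, once $u$ is excluded from the candidate set, all vertices of $P$ can be pruned: the maximum number of edges of a $k$-defective biclique of the form $G(S\cup C')$ with $C'\subseteq C$ equals the maximum of (i) the maximum number of edges of such $k$-defective bicliques with $u\in C'$, and (ii) the maximum number of edges of such $k$-defective bicliques with $C'\subseteq C\setminus(\{u\}\cup P)$.
   Context: For $S=(U_S,V_S)$ with $U_S\subseteq U$, $V_S\subseteq V$, $G(S)$ is the subgraph induced by $U_S\cup V_S$. For a vertex $x$ and a vertex set $X$, $\overline N_X(x)$ is the set of vertices of $X$ on the side opposite to $x$ not adjacent to $x$, and $\overline d_X(x)=|\overline N_X(x)|$. A $k$-defective biclique is a subgraph $(U_D,V_D,E_D)$ with $|(U_D\times V_D)\setminus E_D|\le k$. An instance is a pair $(S,C)$ of disjoint vertex sets $S=(U_S,V_S)$, $C=(U_C,V_C)$ such that $G(S)$ is a $k$-defective biclique and $G(S\cup\{x\})$ is a $k$-defective biclique for every $x\in C$. -}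

module Defs where

open import Data.Nat using (ℕ; _≤_; _≤ᵇ_)
open import Data.Bool using (Bool; true; false; _∧_; not)
open import Data.Fin using (Fin)
open import Data.Fin.Subset as Sub using (Subset; _∈_; _⊆_; ∣_∣; ⁅_⁆)
open import Data.Vec using (Vec; tabulate; lookup; sum)
open import Data.Sum using (_⊎_; inj₁; inj₂)
open import Data.Product using (_×_; ∃; _,_; proj₁; proj₂)
open import Data.Empty using (⊥)
open import Relation.Binary.PropositionalEquality using (_≡_)

-- A bipartite graph G = (U, V, E) with U = Fin m, V = Fin n and
-- edge relation given by a Boolean adjacency function  Adj m n.
Adj : ℕ → ℕ → Set
Adj m n = Fin m → Fin n → Bool

Vertex : ℕ → ℕ → Set
Vertex m n = Fin m ⊎ Fin n

VSet : ℕ → ℕ → Set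
VSet m n = Subset m × Subset n

module _ {m n : ℕ} where

  ∅ : VSet m n
  ∅ = (Sub.⊥ , Sub.⊥)

  _∪ᵥ_ : VSet m n → VSet m n → VSet m n
  (A , B) ∪ᵥ (A' , B') = (A Sub.∪ A' , B Sub.∪ B')

  _─ᵥ_ : VSet m n → VSet m n → VSet m n
  (A , B) ─ᵥ (A' , B') = (A Sub.─ A' , B Sub.─ B')

  _⊆ᵥ_ : VSet m n → VSet m n → Set
  (A , B) ⊆ᵥ (A' , B') = A ⊆ A' × B ⊆ B'

  _∈ᵥ_ : Vertex m n → VSet m n → Set
  inj₁ u ∈ᵥ (A , B) = u ∈ A
  inj₂ v ∈ᵥ (A , B) = v ∈ B

  Disjoint : VSet m n → VSet m n → Set
  Disjoint X Y = ∀ (x : Vertex m n) → x ∈ᵥ X → x ∈ᵥ Y → ⊥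

  ⁅_⁆ᵥ : Vertex m n → VSet m n
  ⁅ inj₁ u ⁆ᵥ = (⁅ u ⁆ , Sub.⊥)
  ⁅ inj₂ v ⁆ᵥ = (Sub.⊥ , ⁅ v ⁆)

  size : VSet m n → ℕ
  size (A , B) = ∣ A ∣ Data.Nat.+ ∣ B ∣

  sameSide : VSet m n → Vertex m n → VSet m n
  sameSide (A , B) (inj₁ _) = (A , Sub.⊥)
  sameSide (A , B) (inj₂ _) = (Sub.⊥ , B)

  edges : Adj m n → VSet m n → ℕ
  edges E (A , B) =
    sum (tabulate λ u → ∣ tabulate (λ v → lookup A u ∧ lookup B v ∧ E u v) ∣)

  missing : Adj m n → VSet m n → ℕ
  missing E (A , B) =
    sum (tabulate λ u → ∣ tabulate (λ v → lookup A u ∧ lookup B v ∧ not (E u v)) ∣)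

  Defective : Adj m n → ℕ → VSet m n → Set
  Defective E k D = missing E D ≤ k

  nonNbr : Adj m n → VSet m n → Vertex m n → VSet m n
  nonNbr E (A , B) (inj₁ u) = (Sub.⊥ , tabulate λ v → lookup B v ∧ not (E u v))
  nonNbr E (A , B) (inj₂ v) = (tabulate (λ u → lookup A u ∧ not (E u v)) , Sub.⊥)

  nonDeg : Adj m n → VSet m n → Vertex m n → ℕ
  nonDeg E X x = size (nonNbr E X x)

  Instance : Adj m n → ℕ → VSet m n → VSet m n → Set
  Instance E k S C =
    Disjoint S C × Defective E k S ×
    (∀ (x : Vertex m n) → x ∈ᵥ C → Defective E k (S ∪ᵥ ⁅ x ⁆ᵥ))

  basePrune : Adj m n → VSet m n → VSet m n → Vertex m n → VSet m n
  basePrune E S C u with sameSide C u ─ᵥ ⁅ u ⁆ᵥ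
  ... | (A , B) =
    ( tabulate (λ i → lookup A i ∧ (1 ≤ᵇ nonDeg E S (inj₁ i)))
    , tabulate (λ j → lookup B j ∧ (1 ≤ᵇ nonDeg E S (inj₂ j))) )

  IsMax : (VSet m n → Set) → (VSet m n → ℕ) → ℕ → Set
  IsMax Q f a = (∃ λ X → Q X × f X ≡ a) × (∀ X → Q X → f X ≤ a)

-- Adding a vertex y to a vertex set D adds d̄_D(y) missing edges and |opposite side of D| − d̄_D(y)
-- edges. Hence replacing a vertex x by a vertex u of the same side with d̄_D(u) ≤ d̄_D(x) neither
-- increases the number of missing edges nor decreases the number of edges.
--
-- Take a k-defective biclique S ∪ X with X ⊆ C. If u ∈ X it is a candidate for (i). Otherwise u has,
-- among S ∪ X, either no non-neighbour, and then S ∪ X ∪ {u} is at least as good, or exactly one,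
-- since d̄_{S∪C}(u) = 1. In the latter case every x ∈ X ∩ P lies on the side of u and has a
-- non-neighbour in S ∪ (X ∖ {x}), so S ∪ (X ∖ {x}) ∪ {u} is at least as good. If X avoids {u} ∪ P,
-- S ∪ X is a candidate for (ii).
module Submission where

open import Defs
open import Data.Bool using (Bool; true; false; _∧_; _∨_; not; T)
open import Data.Bool.Properties using (∧-zeroʳ; ∧-conicalˡ; ∧-conicalʳ; not-injective)
open import Data.Empty using (⊥)
open import Data.Fin using (Fin; zero; suc; _≟_)
import Data.Fin.Properties as Finₚ
open import Data.Fin.Subset as Sub using (Subset; outside; Empty; _∈_; _∉_; ∣_∣; ⁅_⁆; _─_; _∪_; _∩_)
open import Data.Fin.Subset.Properties
  using ( _∈?_; nonempty?; ∉⊥; x∈⁅x⁆; x∈⁅y⁆⇒x≡y; x≢y⇒x∉⁅y⁆; x∈p∪q⁺; x∈p∪q⁻; x∈p∩q⁺; x∈p∩q⁻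
        ; x∈p∧x∉q⇒x∈p─q; p─q⊆p; x∈p∧x≢y⇒x∈p-y; ⊆-trans; ⊆-antisym; ∪-assoc; ∪-identityʳ
        ; Empty-unique; ∣⊥∣≡0; p⊆q⇒∣p∣≤∣q∣; x∈p⇒∣p-x∣<∣p∣ )
open import Data.Nat using (ℕ; zero; suc; _+_; _≤_; _<_; _⊔_; _≤ᵇ_; z≤n)
open import Data.Nat.Properties
  renaming (_≟_ to _≟ℕ_)
  using ( +-0-commutativeMonoid; +-identityʳ; +-assoc; +-mono-≤; +-monoʳ-≤; +-cancelʳ-≤; m≤m+n; m≤n+m
        ; ≤-refl; ≤-reflexive; ≤-trans; ≤-<-trans; ≤-antisym; <⇒≱; ≤ᵇ⇒≤; 1+n≢0; ⊔-lub; m≤m⊔n; m≤n⊔m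
        ; module ≤-Reasoning )
open import Algebra.Properties.CommutativeMonoid.Sum +-0-commutativeMonoid
  using (sum; sum-cong-≗; ∑-distrib-+; sum-replicate-zero)
open import Data.Product using (_×_; _,_; proj₁; proj₂; ∃)
open import Data.Sum using (_⊎_; inj₁; inj₂; map₂)
open import Data.Sum.Properties using (≡-dec)
open import Data.Unit using (⊤; tt)
import Data.Vec as Vec
open import Data.Vec using ([]; _∷_; here; there; tabulate; lookup)
open import Data.Vec.Properties using (lookup∘tabulate; lookup-zipWith; []=⇒lookup; lookup⇒[]=)
open import Function using (_∘_; case_of_)
open import Relation.Binary.PropositionalEquality
  using (_≡_; _≢_; refl; sym; trans; cong; cong₂; subst; module ≡-Reasoning)
open import Relation.Nullary using (¬_; Dec; yes; no; contradiction)

[_] : Bool → ℕ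
[ true ] = 1
[ false ] = 0

count : ∀ {n} → (Fin n → Bool) → ℕ
count p = sum (λ i → [ p i ])

count-false : ∀ {n} → count {n} (λ _ → false) ≡ 0
count-false {n} = sum-replicate-zero n

count-split : ∀ {n} (b c : Fin n → Bool) →
  count (λ i → b i ∧ c i) + count (λ i → b i ∧ not (c i)) ≡ count b
count-split b c =
  trans (sym (∑-distrib-+ (λ i → [ b i ∧ c i ]) (λ i → [ b i ∧ not (c i) ])))
        (sum-cong-≗ λ i → split (b i) (c i))
  where
  split : ∀ x y → [ x ∧ y ] + [ x ∧ not y ] ≡ [ x ]
  split true true = refl
  split true false = refl
  split false y = refl

sum-concentrated : ∀ {n} (f : Fin n → ℕ) (i : Fin n) → (∀ j → j ≢ i → f j ≡ 0) → sum f ≡ f i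
sum-concentrated {suc n} f zero f≡0 = trans (cong (f zero +_) rest≡0) (+-identityʳ (f zero))
  where
  rest≡0 : sum (f ∘ suc) ≡ 0
  rest≡0 = trans (sum-cong-≗ λ j → f≡0 (suc j) λ ()) (sum-replicate-zero n)
sum-concentrated f (suc i) f≡0 =
  trans (cong (_+ sum (f ∘ suc)) (f≡0 zero λ ()))
        (sum-concentrated (f ∘ suc) i λ j j≢i → f≡0 (suc j) (j≢i ∘ Finₚ.suc-injective))

∑∑-distrib-+ : ∀ {m n} (f g : Fin m → Fin n → ℕ) →
  sum (λ i → sum (λ j → f i j + g i j)) ≡ sum (λ i → sum (f i)) + sum (λ i → sum (g i))
∑∑-distrib-+ f g =
  trans (sum-cong-≗ λ i → ∑-distrib-+ (f i) (g i)) (∑-distrib-+ (λ i → sum (f i)) (λ i → sum (g i)))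

sum-tabulate : ∀ {n} (f : Fin n → ℕ) → Vec.sum (tabulate f) ≡ sum f
sum-tabulate {zero} f = refl
sum-tabulate {suc n} f = cong (f zero +_) (sum-tabulate (f ∘ suc))

∣p∣≡count : ∀ {n} (p : Subset n) → ∣ p ∣ ≡ count (lookup p)
∣p∣≡count [] = refl
∣p∣≡count (true ∷ p) = cong suc (∣p∣≡count p)
∣p∣≡count (false ∷ p) = ∣p∣≡count p

∣tabulate∣≡count : ∀ {n} (p : Fin n → Bool) → ∣ tabulate p ∣ ≡ count p
∣tabulate∣≡count p = trans (∣p∣≡count (tabulate p)) (sum-cong-≗ (cong [_] ∘ lookup∘tabulate p))

∈-tabulate⁺ : ∀ {n} {f : Fin n → Bool} {i} → f i ≡ true → i ∈ tabulate f
∈-tabulate⁺ {f = f} {i} fi≡true = lookup⇒[]= i (tabulate f) (trans (lookup∘tabulate f i) fi≡true)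

∈-tabulate⁻ : ∀ {n} {f : Fin n → Bool} {i} → i ∈ tabulate f → f i ≡ true
∈-tabulate⁻ {f = f} {i} i∈ = trans (sym (lookup∘tabulate f i)) ([]=⇒lookup i∈)

lookup-∉ : ∀ {n} {i : Fin n} {p : Subset n} → i ∉ p → lookup p i ≡ false
lookup-∉ {i = i} {p} i∉p with lookup p i in eq
... | true = contradiction (lookup⇒[]= i p eq) i∉p
... | false = refl

lookup-⁅x⁆ : ∀ {n} (x : Fin n) → lookup ⁅ x ⁆ x ≡ true
lookup-⁅x⁆ x = []=⇒lookup (x∈⁅x⁆ x)

lookup-⁅y⁆ : ∀ {n} {x y : Fin n} → x ≢ y → lookup ⁅ y ⁆ x ≡ false
lookup-⁅y⁆ x≢y = lookup-∉ (x≢y⇒x∉⁅y⁆ x≢y)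

x∉p⇒disjoint-⁅x⁆ : ∀ {n} {x : Fin n} {p : Subset n} → x ∉ p → ∀ y → lookup p y ∧ lookup ⁅ x ⁆ y ≡ false
x∉p⇒disjoint-⁅x⁆ {x = x} x∉p y with y ≟ x
... | yes refl = cong (_∧ _) (lookup-∉ x∉p)
... | no y≢x = trans (cong (_ ∧_) (lookup-⁅y⁆ y≢x)) (∧-zeroʳ _)

x∈p─q⇒x∉q : ∀ {n} {x : Fin n} (p q : Subset n) → x ∈ p ─ q → x ∉ q
x∈p─q⇒x∉q (s ∷ p) (outside ∷ q) here ()
x∈p─q⇒x∉q (s ∷ p) (t ∷ q) (there x∈p─q) (there x∈q) = x∈p─q⇒x∉q p q x∈p─q x∈q

x∈p⇒0<∣p∣ : ∀ {n} {x : Fin n} {p : Subset n} → x ∈ p → 0 < ∣ p ∣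
x∈p⇒0<∣p∣ x∈p = ≤-<-trans z≤n (x∈p⇒∣p-x∣<∣p∣ x∈p)

∣p∣≤1⇒unique : ∀ {n} {x y : Fin n} {p : Subset n} → ∣ p ∣ ≤ 1 → x ∈ p → y ∈ p → x ≡ y
∣p∣≤1⇒unique {x = x} {y} ∣p∣≤1 x∈p y∈p with x ≟ y
... | yes x≡y = x≡y
... | no x≢y = contradiction ∣p∣≤1
  (<⇒≱ (≤-<-trans (x∈p⇒0<∣p∣ (x∈p∧x≢y⇒x∈p-y x∈p x≢y)) (x∈p⇒∣p-x∣<∣p∣ y∈p)))

Empty⇒∣p∣≡0 : ∀ {n} {p : Subset n} → Empty p → ∣ p ∣ ≡ 0
Empty⇒∣p∣≡0 {n} p≡∅ = trans (cong ∣_∣ (Empty-unique p≡∅)) (∣⊥∣≡0 n)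

pairs : ∀ {m n} → Subset m → Subset n → (Fin m → Fin n → Bool) → ℕ
pairs A B g = sum (λ i → count (λ j → lookup A i ∧ lookup B j ∧ g i j))

[∨∧] : ∀ x y c → x ∧ y ≡ false → [ (x ∨ y) ∧ c ] ≡ [ x ∧ c ] + [ y ∧ c ]
[∨∧] true false c _ = sym (+-identityʳ _)
[∨∧] false y c _ = refl

pairs-∪ˡ : ∀ {m n} (A A' : Subset m) (B : Subset n) g → (∀ i → lookup A i ∧ lookup A' i ≡ false) →
  pairs (A ∪ A') B g ≡ pairs A B g + pairs A' B g
pairs-∪ˡ A A' B g A#A' =
  trans (sum-cong-≗ λ i → sum-cong-≗ λ j → row i j)
        (∑∑-distrib-+ (λ i j → [ lookup A i ∧ lookup B j ∧ g i j ])
                      (λ i j → [ lookup A' i ∧ lookup B j ∧ g i j ]))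
  where
  row : ∀ i j → [ lookup (A ∪ A') i ∧ lookup B j ∧ g i j ]
              ≡ [ lookup A i ∧ lookup B j ∧ g i j ] + [ lookup A' i ∧ lookup B j ∧ g i j ]
  row i j rewrite lookup-zipWith _∨_ i A A' = [∨∧] (lookup A i) (lookup A' i) _ (A#A' i)

pairs-∪ʳ : ∀ {m n} (A : Subset m) (B B' : Subset n) g → (∀ j → lookup B j ∧ lookup B' j ≡ false) →
  pairs A (B ∪ B') g ≡ pairs A B g + pairs A B' g
pairs-∪ʳ A B B' g B#B' =
  trans (sum-cong-≗ λ i → sum-cong-≗ λ j → column i j)
        (∑∑-distrib-+ (λ i j → [ lookup A i ∧ lookup B j ∧ g i j ])
                      (λ i j → [ lookup A i ∧ lookup B' j ∧ g i j ]))
  where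
  column : ∀ i j → [ lookup A i ∧ lookup (B ∪ B') j ∧ g i j ]
                 ≡ [ lookup A i ∧ lookup B j ∧ g i j ] + [ lookup A i ∧ lookup B' j ∧ g i j ]
  column i j rewrite lookup-zipWith _∨_ j B B' with lookup A i
  ... | true = [∨∧] (lookup B j) (lookup B' j) _ (B#B' j)
  ... | false = refl

pairs-⁅⁆ˡ : ∀ {m n} (i : Fin m) (B : Subset n) g → pairs ⁅ i ⁆ B g ≡ count (λ j → lookup B j ∧ g i j)
pairs-⁅⁆ˡ {n = n} i B g =
  trans (sum-concentrated (λ i' → count (λ j → lookup ⁅ i ⁆ i' ∧ lookup B j ∧ g i' j)) i elsewhere)
        (cong (λ b → count (λ j → b ∧ lookup B j ∧ g i j)) (lookup-⁅x⁆ i))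
  where
  elsewhere : ∀ i' → i' ≢ i → count (λ j → lookup ⁅ i ⁆ i' ∧ lookup B j ∧ g i' j) ≡ 0
  elsewhere i' i'≢i rewrite lookup-⁅y⁆ i'≢i = count-false {n}

pairs-⁅⁆ʳ : ∀ {m n} (A : Subset m) (j : Fin n) g → pairs A ⁅ j ⁆ g ≡ count (λ i → lookup A i ∧ g i j)
pairs-⁅⁆ʳ A j g = sum-cong-≗ λ i →
  trans (sum-concentrated (λ j' → [ lookup A i ∧ lookup ⁅ j ⁆ j' ∧ g i j' ]) j (elsewhere i))
        (cong (λ b → [ lookup A i ∧ b ∧ g i j ]) (lookup-⁅x⁆ j))
  where
  elsewhere : ∀ i j' → j' ≢ j → [ lookup A i ∧ lookup ⁅ j ⁆ j' ∧ g i j' ] ≡ 0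
  elsewhere i j' j'≢j rewrite lookup-⁅y⁆ j'≢j | ∧-zeroʳ (lookup A i) = refl

module _ {m n : ℕ} where

  _≟ᵥ_ : ∀ (x y : Vertex m n) → Dec (x ≡ y)
  _≟ᵥ_ = ≡-dec _≟_ _≟_

  _∈ᵥ?_ : ∀ (x : Vertex m n) X → Dec (x ∈ᵥ X)
  inj₁ i ∈ᵥ? (A , B) = i ∈? A
  inj₂ j ∈ᵥ? (A , B) = j ∈? B

  ∈ᵥ-∪⁺ : ∀ {x : Vertex m n} X Y → x ∈ᵥ X ⊎ x ∈ᵥ Y → x ∈ᵥ (X ∪ᵥ Y)
  ∈ᵥ-∪⁺ {inj₁ i} (A , B) (A' , B') = x∈p∪q⁺
  ∈ᵥ-∪⁺ {inj₂ j} (A , B) (A' , B') = x∈p∪q⁺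

  ∈ᵥ-∪⁻ : ∀ {x : Vertex m n} X Y → x ∈ᵥ (X ∪ᵥ Y) → x ∈ᵥ X ⊎ x ∈ᵥ Y
  ∈ᵥ-∪⁻ {inj₁ i} (A , B) (A' , B') = x∈p∪q⁻ A A'
  ∈ᵥ-∪⁻ {inj₂ j} (A , B) (A' , B') = x∈p∪q⁻ B B'

  ∈ᵥ-─⁺ : ∀ {x : Vertex m n} X Y → x ∈ᵥ X → ¬ x ∈ᵥ Y → x ∈ᵥ (X ─ᵥ Y)
  ∈ᵥ-─⁺ {inj₁ i} (A , B) (A' , B') = x∈p∧x∉q⇒x∈p─q
  ∈ᵥ-─⁺ {inj₂ j} (A , B) (A' , B') = x∈p∧x∉q⇒x∈p─q

  ∈ᵥ-─⁻ : ∀ {x : Vertex m n} X Y → x ∈ᵥ (X ─ᵥ Y) → x ∈ᵥ X × ¬ x ∈ᵥ Y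
  ∈ᵥ-─⁻ {inj₁ i} (A , B) (A' , B') i∈ = p─q⊆p A A' i∈ , x∈p─q⇒x∉q A A' i∈
  ∈ᵥ-─⁻ {inj₂ j} (A , B) (A' , B') j∈ = p─q⊆p B B' j∈ , x∈p─q⇒x∉q B B' j∈

  x∈ᵥ⁅x⁆ᵥ : ∀ (x : Vertex m n) → x ∈ᵥ ⁅ x ⁆ᵥ
  x∈ᵥ⁅x⁆ᵥ (inj₁ i) = x∈⁅x⁆ i
  x∈ᵥ⁅x⁆ᵥ (inj₂ j) = x∈⁅x⁆ j

  x∈ᵥ⁅y⁆ᵥ⇒x≡y : ∀ {x : Vertex m n} y → x ∈ᵥ ⁅ y ⁆ᵥ → x ≡ y
  x∈ᵥ⁅y⁆ᵥ⇒x≡y {inj₁ i} (inj₁ i') i∈ = cong inj₁ (x∈⁅y⁆⇒x≡y i' i∈)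
  x∈ᵥ⁅y⁆ᵥ⇒x≡y {inj₂ j} (inj₂ j') j∈ = cong inj₂ (x∈⁅y⁆⇒x≡y j' j∈)
  x∈ᵥ⁅y⁆ᵥ⇒x≡y {inj₁ i} (inj₂ j') i∈ = contradiction i∈ ∉⊥
  x∈ᵥ⁅y⁆ᵥ⇒x≡y {inj₂ j} (inj₁ i') j∈ = contradiction j∈ ∉⊥

  ∈ᵥ-⊆ᵥ : ∀ {x : Vertex m n} {X Y} → X ⊆ᵥ Y → x ∈ᵥ X → x ∈ᵥ Y
  ∈ᵥ-⊆ᵥ {inj₁ i} {A , B} {A' , B'} (A⊆A' , _) = A⊆A'
  ∈ᵥ-⊆ᵥ {inj₂ j} {A , B} {A' , B'} (_ , B⊆B') = B⊆B'

  ⊆ᵥ-from-∈ᵥ : ∀ (X Y : VSet m n) → (∀ x → x ∈ᵥ X → x ∈ᵥ Y) → X ⊆ᵥ Y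
  ⊆ᵥ-from-∈ᵥ (A , B) (A' , B') X⊆Y = X⊆Y (inj₁ _) , X⊆Y (inj₂ _)

  ⊆ᵥ-trans : ∀ {X Y Z : VSet m n} → X ⊆ᵥ Y → Y ⊆ᵥ Z → X ⊆ᵥ Z
  ⊆ᵥ-trans {A , B} {A' , B'} {A'' , B''} (A⊆ , B⊆) (A'⊆ , B'⊆) = ⊆-trans A⊆ A'⊆ , ⊆-trans B⊆ B'⊆

  ⊆ᵥ-antisym : ∀ {X Y : VSet m n} → X ⊆ᵥ Y → Y ⊆ᵥ X → X ≡ Y
  ⊆ᵥ-antisym {A , B} {A' , B'} (A⊆ , B⊆) (A⊇ , B⊇) = cong₂ _,_ (⊆-antisym A⊆ A⊇) (⊆-antisym B⊆ B⊇)

  ─ᵥ-⊆ᵥ : ∀ (X Y : VSet m n) → (X ─ᵥ Y) ⊆ᵥ X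
  ─ᵥ-⊆ᵥ X Y = ⊆ᵥ-from-∈ᵥ _ X λ x x∈ → proj₁ (∈ᵥ-─⁻ X Y x∈)

  ∪ᵥ-monoʳ : ∀ Z {X Y : VSet m n} → X ⊆ᵥ Y → (Z ∪ᵥ X) ⊆ᵥ (Z ∪ᵥ Y)
  ∪ᵥ-monoʳ Z {X} {Y} X⊆Y = ⊆ᵥ-from-∈ᵥ _ _ λ x x∈ → ∈ᵥ-∪⁺ Z Y (map₂ (∈ᵥ-⊆ᵥ X⊆Y) (∈ᵥ-∪⁻ Z X x∈))

  ∪⁅y⁆ᵥ-⊆ᵥ : ∀ {X Y : VSet m n} {y} → X ⊆ᵥ Y → y ∈ᵥ Y → (X ∪ᵥ ⁅ y ⁆ᵥ) ⊆ᵥ Y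
  ∪⁅y⁆ᵥ-⊆ᵥ {X} {Y} {y} X⊆Y y∈Y = ⊆ᵥ-from-∈ᵥ _ Y λ x x∈ → case ∈ᵥ-∪⁻ X ⁅ y ⁆ᵥ x∈ of λ where
    (inj₁ x∈X) → ∈ᵥ-⊆ᵥ X⊆Y x∈X
    (inj₂ x∈⁅y⁆) → subst (_∈ᵥ Y) (sym (x∈ᵥ⁅y⁆ᵥ⇒x≡y y x∈⁅y⁆)) y∈Y

  ∪ᵥ-assoc : ∀ (X Y Z : VSet m n) → X ∪ᵥ (Y ∪ᵥ Z) ≡ (X ∪ᵥ Y) ∪ᵥ Z
  ∪ᵥ-assoc (A , B) (A' , B') (A'' , B'') = sym (cong₂ _,_ (∪-assoc A A' A'') (∪-assoc B B' B''))

  ─⁅x⁆ᵥ∪⁅x⁆ᵥ : ∀ {x : Vertex m n} X → x ∈ᵥ X → (X ─ᵥ ⁅ x ⁆ᵥ) ∪ᵥ ⁅ x ⁆ᵥ ≡ X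
  ─⁅x⁆ᵥ∪⁅x⁆ᵥ {x} X x∈X = ⊆ᵥ-antisym (∪⁅y⁆ᵥ-⊆ᵥ (─ᵥ-⊆ᵥ X ⁅ x ⁆ᵥ) x∈X) (⊆ᵥ-from-∈ᵥ X _ X⊆)
    where
    X⊆ : ∀ y → y ∈ᵥ X → y ∈ᵥ ((X ─ᵥ ⁅ x ⁆ᵥ) ∪ᵥ ⁅ x ⁆ᵥ)
    X⊆ y y∈X with y ≟ᵥ x
    ... | yes refl = ∈ᵥ-∪⁺ (X ─ᵥ ⁅ x ⁆ᵥ) ⁅ x ⁆ᵥ (inj₂ (x∈ᵥ⁅x⁆ᵥ x))
    ... | no y≢x = ∈ᵥ-∪⁺ (X ─ᵥ ⁅ x ⁆ᵥ) ⁅ x ⁆ᵥ (inj₁ (∈ᵥ-─⁺ X ⁅ x ⁆ᵥ y∈X (y≢x ∘ x∈ᵥ⁅y⁆ᵥ⇒x≡y x)))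

  meets-or-disjoint : ∀ (X Y : VSet m n) → (∃ λ x → x ∈ᵥ X × x ∈ᵥ Y) ⊎ Disjoint X Y
  meets-or-disjoint (A , B) (A' , B') with nonempty? (A ∩ A') | nonempty? (B ∩ B')
  ... | yes (i , i∈) | _ = inj₁ (inj₁ i , x∈p∩q⁻ A A' i∈)
  ... | no _ | yes (j , j∈) = inj₁ (inj₂ j , x∈p∩q⁻ B B' j∈)
  ... | no A∩A'≡∅ | no B∩B'≡∅ = inj₂ λ where
    (inj₁ i) i∈A i∈A' → A∩A'≡∅ (i , x∈p∩q⁺ (i∈A , i∈A'))
    (inj₂ j) j∈B j∈B' → B∩B'≡∅ (j , x∈p∩q⁺ (j∈B , j∈B'))

  size-mono : ∀ {X Y : VSet m n} → X ⊆ᵥ Y → size X ≤ size Y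
  size-mono {A , B} {A' , B'} (A⊆ , B⊆) = +-mono-≤ (p⊆q⇒∣p∣≤∣q∣ A⊆) (p⊆q⇒∣p∣≤∣q∣ B⊆)

  ∈ᵥ⇒0<size : ∀ {x : Vertex m n} {X} → x ∈ᵥ X → 0 < size X
  ∈ᵥ⇒0<size {inj₁ i} {A , B} i∈A = ≤-trans (x∈p⇒0<∣p∣ i∈A) (m≤m+n ∣ A ∣ ∣ B ∣)
  ∈ᵥ⇒0<size {inj₂ j} {A , B} j∈B = ≤-trans (x∈p⇒0<∣p∣ j∈B) (m≤n+m ∣ B ∣ ∣ A ∣)

  size≢0⇒nonempty : ∀ {X : VSet m n} → size X ≢ 0 → ∃ λ x → x ∈ᵥ X
  size≢0⇒nonempty {A , B} size≢0 with nonempty? A | nonempty? B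
  ... | yes (i , i∈A) | _ = inj₁ i , i∈A
  ... | no _ | yes (j , j∈B) = inj₂ j , j∈B
  ... | no A≡∅ | no B≡∅ = contradiction (cong₂ _+_ (Empty⇒∣p∣≡0 A≡∅) (Empty⇒∣p∣≡0 B≡∅)) size≢0

  size≤1⇒unique : ∀ {X : VSet m n} {x y} → size X ≤ 1 → x ∈ᵥ X → y ∈ᵥ X → x ≡ y
  size≤1⇒unique {A , B} {inj₁ i} {inj₁ i'} ≤1 i∈A i'∈A =
    cong inj₁ (∣p∣≤1⇒unique (≤-trans (m≤m+n ∣ A ∣ ∣ B ∣) ≤1) i∈A i'∈A)
  size≤1⇒unique {A , B} {inj₂ j} {inj₂ j'} ≤1 j∈B j'∈B =
    cong inj₂ (∣p∣≤1⇒unique (≤-trans (m≤n+m ∣ B ∣ ∣ A ∣) ≤1) j∈B j'∈B)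
  size≤1⇒unique {A , B} {inj₁ i} {inj₂ j} ≤1 i∈A j∈B =
    contradiction ≤1 (<⇒≱ (+-mono-≤ (x∈p⇒0<∣p∣ i∈A) (x∈p⇒0<∣p∣ j∈B)))
  size≤1⇒unique {A , B} {inj₂ j} {inj₁ i} ≤1 j∈B i∈A =
    contradiction ≤1 (<⇒≱ (+-mono-≤ (x∈p⇒0<∣p∣ i∈A) (x∈p⇒0<∣p∣ j∈B)))

-- Inserting a vertex

module _ {m n : ℕ} where

  pairsᵥ : (Fin m → Fin n → Bool) → VSet m n → ℕ
  pairsᵥ g (A , B) = pairs A B g

  degᵥ : (Fin m → Fin n → Bool) → VSet m n → Vertex m n → ℕ
  degᵥ g (A , B) (inj₁ i) = count (λ j → lookup B j ∧ g i j)
  degᵥ g (A , B) (inj₂ j) = count (λ i → lookup A i ∧ g i j)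

  complement : Adj m n → Adj m n
  complement E i j = not (E i j)

  oppositeSize : VSet m n → Vertex m n → ℕ
  oppositeSize (A , B) (inj₁ _) = ∣ B ∣
  oppositeSize (A , B) (inj₂ _) = ∣ A ∣

  SameSide : Vertex m n → Vertex m n → Set
  SameSide (inj₁ _) (inj₁ _) = ⊤
  SameSide (inj₂ _) (inj₂ _) = ⊤
  SameSide _ _ = ⊥

  oppositeSize-SameSide : ∀ D {x y} → SameSide x y → oppositeSize D x ≡ oppositeSize D y
  oppositeSize-SameSide (A , B) {inj₁ _} {inj₁ _} _ = refl
  oppositeSize-SameSide (A , B) {inj₂ _} {inj₂ _} _ = refl

  pairsᵥ-insert : ∀ g D y → ¬ y ∈ᵥ D → pairsᵥ g (D ∪ᵥ ⁅ y ⁆ᵥ) ≡ pairsᵥ g D + degᵥ g D y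
  pairsᵥ-insert g (A , B) (inj₁ i) i∉A rewrite ∪-identityʳ B =
    trans (pairs-∪ˡ A ⁅ i ⁆ B g (x∉p⇒disjoint-⁅x⁆ i∉A)) (cong (pairs A B g +_) (pairs-⁅⁆ˡ i B g))
  pairsᵥ-insert g (A , B) (inj₂ j) j∉B rewrite ∪-identityʳ A =
    trans (pairs-∪ʳ A B ⁅ j ⁆ g (x∉p⇒disjoint-⁅x⁆ j∉B)) (cong (pairs A B g +_) (pairs-⁅⁆ʳ A j g))

  degᵥ-complement : ∀ g D y → degᵥ g D y + degᵥ (complement g) D y ≡ oppositeSize D y
  degᵥ-complement g (A , B) (inj₁ i) = trans (count-split (lookup B) (g i)) (sym (∣p∣≡count B))
  degᵥ-complement g (A , B) (inj₂ j) = trans (count-split (lookup A) (λ i → g i j)) (sym (∣p∣≡count A))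

  edges≡pairsᵥ : ∀ E D → edges E D ≡ pairsᵥ E D
  edges≡pairsᵥ E (A , B) =
    trans (sum-tabulate {m} _) (sum-cong-≗ λ i → ∣tabulate∣≡count (λ j → lookup A i ∧ lookup B j ∧ E i j))

  missing≡pairsᵥ : ∀ E D → missing E D ≡ pairsᵥ (complement E) D
  missing≡pairsᵥ E (A , B) =
    trans (sum-tabulate {m} _) (sum-cong-≗ λ i → ∣tabulate∣≡count (λ j → lookup A i ∧ lookup B j ∧ not (E i j)))

  nonDeg≡degᵥ : ∀ E D y → nonDeg E D y ≡ degᵥ (complement E) D y
  nonDeg≡degᵥ E (A , B) (inj₁ i) = cong₂ _+_ (∣⊥∣≡0 m) (∣tabulate∣≡count (λ j → lookup B j ∧ not (E i j)))
  nonDeg≡degᵥ E (A , B) (inj₂ j) =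
    trans (cong₂ _+_ (∣tabulate∣≡count (λ i → lookup A i ∧ not (E i j))) (∣⊥∣≡0 n)) (+-identityʳ _)

  missing-insert : ∀ E D y → ¬ y ∈ᵥ D → missing E (D ∪ᵥ ⁅ y ⁆ᵥ) ≡ missing E D + nonDeg E D y
  missing-insert E D y y∉D = begin
    missing E (D ∪ᵥ ⁅ y ⁆ᵥ)                             ≡⟨ missing≡pairsᵥ E (D ∪ᵥ ⁅ y ⁆ᵥ) ⟩
    pairsᵥ (complement E) (D ∪ᵥ ⁅ y ⁆ᵥ)                  ≡⟨ pairsᵥ-insert (complement E) D y y∉D ⟩
    pairsᵥ (complement E) D + degᵥ (complement E) D y    ≡⟨ cong₂ _+_ (missing≡pairsᵥ E D) (nonDeg≡degᵥ E D y) ⟨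
    missing E D + nonDeg E D y                           ∎
    where open ≡-Reasoning

  edges-insert : ∀ E D y → ¬ y ∈ᵥ D → edges E (D ∪ᵥ ⁅ y ⁆ᵥ) + nonDeg E D y ≡ edges E D + oppositeSize D y
  edges-insert E D y y∉D = begin
    edges E (D ∪ᵥ ⁅ y ⁆ᵥ) + nonDeg E D y
      ≡⟨ cong₂ _+_ (trans (edges≡pairsᵥ E (D ∪ᵥ ⁅ y ⁆ᵥ)) (pairsᵥ-insert E D y y∉D)) (nonDeg≡degᵥ E D y) ⟩
    pairsᵥ E D + degᵥ E D y + degᵥ (complement E) D y
      ≡⟨ +-assoc (pairsᵥ E D) _ _ ⟩
    pairsᵥ E D + (degᵥ E D y + degᵥ (complement E) D y)
      ≡⟨ cong₂ _+_ (sym (edges≡pairsᵥ E D)) (degᵥ-complement E D y) ⟩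
    edges E D + oppositeSize D y
      ∎
    where open ≡-Reasoning

  insert-isolated : ∀ E D y → ¬ y ∈ᵥ D → nonDeg E D y ≡ 0 →
    missing E (D ∪ᵥ ⁅ y ⁆ᵥ) ≡ missing E D × edges E D ≤ edges E (D ∪ᵥ ⁅ y ⁆ᵥ)
  insert-isolated E D y y∉D d̄y≡0 =
    trans (missing-insert E D y y∉D) (trans (cong (missing E D +_) d̄y≡0) (+-identityʳ _)) ,
    (begin
      edges E D                              ≤⟨ m≤m+n (edges E D) (oppositeSize D y) ⟩
      edges E D + oppositeSize D y           ≡⟨ edges-insert E D y y∉D ⟨
      edges E (D ∪ᵥ ⁅ y ⁆ᵥ) + nonDeg E D y   ≡⟨ cong (edges E (D ∪ᵥ ⁅ y ⁆ᵥ) +_) d̄y≡0 ⟩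
      edges E (D ∪ᵥ ⁅ y ⁆ᵥ) + 0              ≡⟨ +-identityʳ _ ⟩
      edges E (D ∪ᵥ ⁅ y ⁆ᵥ)                  ∎)
    where open ≤-Reasoning

  exchange : ∀ E D {x y} → ¬ x ∈ᵥ D → ¬ y ∈ᵥ D → SameSide x y → nonDeg E D y ≤ nonDeg E D x →
    missing E (D ∪ᵥ ⁅ y ⁆ᵥ) ≤ missing E (D ∪ᵥ ⁅ x ⁆ᵥ) × edges E (D ∪ᵥ ⁅ x ⁆ᵥ) ≤ edges E (D ∪ᵥ ⁅ y ⁆ᵥ)
  exchange E D {x} {y} x∉D y∉D x~y d̄y≤d̄x =
    (begin
      missing E (D ∪ᵥ ⁅ y ⁆ᵥ)     ≡⟨ missing-insert E D y y∉D ⟩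
      missing E D + nonDeg E D y  ≤⟨ +-monoʳ-≤ (missing E D) d̄y≤d̄x ⟩
      missing E D + nonDeg E D x  ≡⟨ missing-insert E D x x∉D ⟨
      missing E (D ∪ᵥ ⁅ x ⁆ᵥ)     ∎) ,
    +-cancelʳ-≤ (nonDeg E D x) _ _ (begin
      edges E (D ∪ᵥ ⁅ x ⁆ᵥ) + nonDeg E D x  ≡⟨ edges-insert E D x x∉D ⟩
      edges E D + oppositeSize D x          ≡⟨ cong (edges E D +_) (oppositeSize-SameSide D x~y) ⟩
      edges E D + oppositeSize D y          ≡⟨ edges-insert E D y y∉D ⟨
      edges E (D ∪ᵥ ⁅ y ⁆ᵥ) + nonDeg E D y  ≤⟨ +-monoʳ-≤ (edges E (D ∪ᵥ ⁅ y ⁆ᵥ)) d̄y≤d̄x ⟩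
      edges E (D ∪ᵥ ⁅ y ⁆ᵥ) + nonDeg E D x  ∎)
    where open ≤-Reasoning

-- Non-neighbourhoods

module _ {m n : ℕ} where

  NonAdj : Adj m n → Vertex m n → Vertex m n → Set
  NonAdj E (inj₁ i) (inj₂ j) = E i j ≡ false
  NonAdj E (inj₂ j) (inj₁ i) = E i j ≡ false
  NonAdj E (inj₁ _) (inj₁ _) = ⊥
  NonAdj E (inj₂ _) (inj₂ _) = ⊥

  NonAdj-sym : ∀ E {x y : Vertex m n} → NonAdj E x y → NonAdj E y x
  NonAdj-sym E {inj₁ i} {inj₂ j} Eij≡false = Eij≡false
  NonAdj-sym E {inj₂ j} {inj₁ i} Eij≡false = Eij≡false

  NonAdj⇒≢ : ∀ E {x y : Vertex m n} → NonAdj E x y → x ≢ y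
  NonAdj⇒≢ E {inj₁ i} {inj₂ j} _ ()
  NonAdj⇒≢ E {inj₂ j} {inj₁ i} _ ()

  NonAdj-SameSide : ∀ E {x y z : Vertex m n} → NonAdj E x y → NonAdj E y z → SameSide z x
  NonAdj-SameSide E {inj₁ _} {inj₂ _} {inj₁ _} _ _ = tt
  NonAdj-SameSide E {inj₂ _} {inj₁ _} {inj₂ _} _ _ = tt

  ∈-nonNbr⁺ : ∀ E X {y z : Vertex m n} → z ∈ᵥ X → NonAdj E y z → z ∈ᵥ nonNbr E X y
  ∈-nonNbr⁺ E (A , B) {inj₁ i} {inj₂ j} j∈B Eij≡false =
    ∈-tabulate⁺ (cong₂ (λ b e → b ∧ not e) ([]=⇒lookup j∈B) Eij≡false)
  ∈-nonNbr⁺ E (A , B) {inj₂ j} {inj₁ i} i∈A Eij≡false =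
    ∈-tabulate⁺ (cong₂ (λ a e → a ∧ not e) ([]=⇒lookup i∈A) Eij≡false)

  ∈-nonNbr⁻ : ∀ E X {y z : Vertex m n} → z ∈ᵥ nonNbr E X y → z ∈ᵥ X × NonAdj E y z
  ∈-nonNbr⁻ E (A , B) {inj₁ i} {inj₂ j} j∈ = split (∈-tabulate⁻ j∈)
    where
    split : lookup B j ∧ not (E i j) ≡ true → j ∈ B × E i j ≡ false
    split eq = lookup⇒[]= j B (∧-conicalˡ _ _ eq) , not-injective (∧-conicalʳ _ _ eq)
  ∈-nonNbr⁻ E (A , B) {inj₂ j} {inj₁ i} i∈ = split (∈-tabulate⁻ i∈)
    where
    split : lookup A i ∧ not (E i j) ≡ true → i ∈ A × E i j ≡ false
    split eq = lookup⇒[]= i A (∧-conicalˡ _ _ eq) , not-injective (∧-conicalʳ _ _ eq)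
  ∈-nonNbr⁻ E (A , B) {inj₁ i} {inj₁ i'} i'∈⊥ = contradiction i'∈⊥ ∉⊥
  ∈-nonNbr⁻ E (A , B) {inj₂ j} {inj₂ j'} j'∈⊥ = contradiction j'∈⊥ ∉⊥

  nonDeg-mono : ∀ E {X Y} (y : Vertex m n) → X ⊆ᵥ Y → nonDeg E X y ≤ nonDeg E Y y
  nonDeg-mono E {X} {Y} y X⊆Y = size-mono {X = nonNbr E X y} {Y = nonNbr E Y y} (⊆ᵥ-from-∈ᵥ _ _ λ z z∈ →
    let z∈X , y≁z = ∈-nonNbr⁻ E X {y} z∈ in ∈-nonNbr⁺ E Y (∈ᵥ-⊆ᵥ X⊆Y z∈X) y≁z)

  nonDeg-pos : ∀ E X {y z : Vertex m n} → z ∈ᵥ X → NonAdj E y z → 0 < nonDeg E X y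
  nonDeg-pos E X z∈X y≁z = ∈ᵥ⇒0<size (∈-nonNbr⁺ E X z∈X y≁z)

  nonDeg-witness : ∀ E X (y : Vertex m n) → nonDeg E X y ≢ 0 → ∃ λ z → z ∈ᵥ X × NonAdj E y z
  nonDeg-witness E X y d̄y≢0 = let z , z∈ = size≢0⇒nonempty d̄y≢0 in z , ∈-nonNbr⁻ E X z∈

  nonDeg-unique : ∀ E X {y z z' : Vertex m n} → nonDeg E X y ≤ 1 →
    z ∈ᵥ X → NonAdj E y z → z' ∈ᵥ X → NonAdj E y z' → z ≡ z'
  nonDeg-unique E X d̄y≤1 z∈X y≁z z'∈X y≁z' =
    size≤1⇒unique d̄y≤1 (∈-nonNbr⁺ E X z∈X y≁z) (∈-nonNbr⁺ E X z'∈X y≁z')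

  ≤ᵇ≡true⇒≤ : ∀ {a b} → (a ≤ᵇ b) ≡ true → a ≤ b
  ≤ᵇ≡true⇒≤ {a} {b} eq = ≤ᵇ⇒≤ a b (subst T (sym eq) tt)

  ∈-basePrune⁻ : ∀ E S C (u : Vertex m n) {x} → x ∈ᵥ basePrune E S C u → SameSide x u × 0 < nonDeg E S x
  ∈-basePrune⁻ E S (A , B) (inj₁ i₀) {inj₁ i} i∈ = tt , ≤ᵇ≡true⇒≤ (∧-conicalʳ _ _ (∈-tabulate⁻ i∈))
  ∈-basePrune⁻ E S (A , B) (inj₂ j₀) {inj₂ j} j∈ = tt , ≤ᵇ≡true⇒≤ (∧-conicalʳ _ _ (∈-tabulate⁻ j∈))
  ∈-basePrune⁻ E S (A , B) (inj₁ i₀) {inj₂ j} j∈ =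
    contradiction (p─q⊆p Sub.⊥ Sub.⊥ (lookup⇒[]= j _ (∧-conicalˡ _ _ (∈-tabulate⁻ j∈)))) ∉⊥
  ∈-basePrune⁻ E S (A , B) (inj₂ j₀) {inj₁ i} i∈ =
    contradiction (p─q⊆p Sub.⊥ Sub.⊥ (lookup⇒[]= i _ (∧-conicalˡ _ _ (∈-tabulate⁻ i∈)))) ∉⊥

-- Pruning

max-split : ∀ {m n} {Q Q₁ Q₂ : VSet m n → Set} {f : VSet m n → ℕ} {a b c} →
  IsMax Q f a → IsMax Q₁ f b → IsMax Q₂ f c →
  (∀ {X} → Q₁ X → Q X) → (∀ {X} → Q₂ X → Q X) →
  (∀ {X} → Q X → (∃ λ X' → Q₁ X' × f X ≤ f X') ⊎ Q₂ X) →
  a ≡ b ⊔ c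
max-split {a = a} {b} {c} ((X , QX , fX≡a) , a-max) ((Y , Q₁Y , fY≡b) , b-max) ((Z , Q₂Z , fZ≡c) , c-max)
      Q₁⇒Q Q₂⇒Q Q⇒Q₁-or-Q₂ = ≤-antisym a≤b⊔c (⊔-lub b≤a c≤a)
  where
  b≤a : b ≤ a
  b≤a = subst (_≤ a) fY≡b (a-max Y (Q₁⇒Q Q₁Y))
  c≤a : c ≤ a
  c≤a = subst (_≤ a) fZ≡c (a-max Z (Q₂⇒Q Q₂Z))
  a≤b⊔c : a ≤ b ⊔ c
  a≤b⊔c rewrite sym fX≡a with Q⇒Q₁-or-Q₂ QX
  ... | inj₁ (X' , Q₁X' , fX≤fX') = ≤-trans fX≤fX' (≤-trans (b-max X' Q₁X') (m≤m⊔n b c))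
  ... | inj₂ Q₂X = ≤-trans (c-max X Q₂X) (m≤n⊔m b c)

module Pruning {m n} (E : Adj m n) (k : ℕ) (S C : VSet m n) (S#C : Disjoint S C)
  (u : Vertex m n) (u∈C : u ∈ᵥ C) (d̄u≡1 : nonDeg E (S ∪ᵥ C) u ≡ 1) where

  SolutionWith-u : VSet m n → Set
  SolutionWith-u X = X ⊆ᵥ C × Defective E k (S ∪ᵥ X) × u ∈ᵥ X

  Dominated : VSet m n → Set
  Dominated X = ∃ λ X' → SolutionWith-u X' × edges E (S ∪ᵥ X) ≤ edges E (S ∪ᵥ X')

  ∉S∪ : ∀ {y X} → y ∈ᵥ C → ¬ y ∈ᵥ X → ¬ y ∈ᵥ (S ∪ᵥ X)
  ∉S∪ {y} {X} y∈C y∉X y∈S∪X = case ∈ᵥ-∪⁻ S X y∈S∪X of λ where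
    (inj₁ y∈S) → S#C y y∈S y∈C
    (inj₂ y∈X) → y∉X y∈X

  nonDeg-u≤1 : ∀ {X} → X ⊆ᵥ C → nonDeg E (S ∪ᵥ X) u ≤ 1
  nonDeg-u≤1 {X} X⊆C = subst (nonDeg E (S ∪ᵥ X) u ≤_) d̄u≡1 (nonDeg-mono E u (∪ᵥ-monoʳ S X⊆C))

  dominated-by-∪⁅u⁆ : ∀ {X X₀} → X₀ ⊆ᵥ C → missing E ((S ∪ᵥ X₀) ∪ᵥ ⁅ u ⁆ᵥ) ≤ k →
    edges E (S ∪ᵥ X) ≤ edges E ((S ∪ᵥ X₀) ∪ᵥ ⁅ u ⁆ᵥ) → Dominated X
  dominated-by-∪⁅u⁆ {X} {X₀} X₀⊆C defective more-edges =
    X₀ ∪ᵥ ⁅ u ⁆ᵥ ,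
    ( ∪⁅y⁆ᵥ-⊆ᵥ X₀⊆C u∈C
    , subst (λ D → missing E D ≤ k) (sym (∪ᵥ-assoc S X₀ ⁅ u ⁆ᵥ)) defective
    , ∈ᵥ-∪⁺ X₀ ⁅ u ⁆ᵥ (inj₂ (x∈ᵥ⁅x⁆ᵥ u)) ) ,
    subst (λ D → edges E (S ∪ᵥ X) ≤ edges E D) (sym (∪ᵥ-assoc S X₀ ⁅ u ⁆ᵥ)) more-edges

  insert-u : ∀ {X} → X ⊆ᵥ C → Defective E k (S ∪ᵥ X) → ¬ u ∈ᵥ X → nonDeg E (S ∪ᵥ X) u ≡ 0 → Dominated X
  insert-u {X} X⊆C defective u∉X d̄u≡0 =
    let missing≡ , more-edges = insert-isolated E (S ∪ᵥ X) u (∉S∪ u∈C u∉X) d̄u≡0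
    in dominated-by-∪⁅u⁆ X⊆C (subst (_≤ k) (sym missing≡) defective) more-edges

  swap-for-u : ∀ {X x} → X ⊆ᵥ C → Defective E k (S ∪ᵥ X) → ¬ u ∈ᵥ X → x ∈ᵥ X → SameSide x u →
    0 < nonDeg E (S ∪ᵥ (X ─ᵥ ⁅ x ⁆ᵥ)) x → Dominated X
  swap-for-u {X} {x} X⊆C defective u∉X x∈X x~u 0<d̄x =
    let fewer-missing , more-edges = exchange E (S ∪ᵥ X₀) x∉S∪X₀ u∉S∪X₀ x~u (≤-trans (nonDeg-u≤1 X₀⊆C) 0<d̄x)
    in dominated-by-∪⁅u⁆ X₀⊆C
         (≤-trans fewer-missing (subst (λ D → missing E D ≤ k) S∪X≡ defective))
         (subst (λ D → edges E D ≤ edges E ((S ∪ᵥ X₀) ∪ᵥ ⁅ u ⁆ᵥ)) (sym S∪X≡) more-edges)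
    where
    X₀ : VSet m n
    X₀ = X ─ᵥ ⁅ x ⁆ᵥ
    X₀⊆C : X₀ ⊆ᵥ C
    X₀⊆C = ⊆ᵥ-trans (─ᵥ-⊆ᵥ X ⁅ x ⁆ᵥ) X⊆C
    S∪X≡ : S ∪ᵥ X ≡ (S ∪ᵥ X₀) ∪ᵥ ⁅ x ⁆ᵥ
    S∪X≡ = trans (cong (S ∪ᵥ_) (sym (─⁅x⁆ᵥ∪⁅x⁆ᵥ X x∈X))) (∪ᵥ-assoc S X₀ ⁅ x ⁆ᵥ)
    x∉S∪X₀ : ¬ x ∈ᵥ (S ∪ᵥ X₀)
    x∉S∪X₀ = ∉S∪ (∈ᵥ-⊆ᵥ X⊆C x∈X) λ x∈X₀ → proj₂ (∈ᵥ-─⁻ X ⁅ x ⁆ᵥ x∈X₀) (x∈ᵥ⁅x⁆ᵥ x)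
    u∉S∪X₀ : ¬ u ∈ᵥ (S ∪ᵥ X₀)
    u∉S∪X₀ = ∉S∪ u∈C (u∉X ∘ proj₁ ∘ ∈ᵥ-─⁻ X ⁅ x ⁆ᵥ)

  module _ (P : VSet m n) (P-base : nonDeg E C u ≢ 1 → P ≡ basePrune E S C u)
    (P-extended : ∀ w → nonDeg E C u ≡ 1 → w ∈ᵥ nonNbr E C u → P ≡ (basePrune E S C u ∪ᵥ nonNbr E C w)) where

    basePrune-swappable : ∀ {X x} → x ∈ᵥ basePrune E S C u →
      SameSide x u × 0 < nonDeg E (S ∪ᵥ (X ─ᵥ ⁅ x ⁆ᵥ)) x
    basePrune-swappable {X} {x} x∈P₀ =
      let x~u , 0<d̄x = ∈-basePrune⁻ E S C u x∈P₀
      in x~u , ≤-trans 0<d̄x (nonDeg-mono E x (⊆ᵥ-from-∈ᵥ S _ λ y y∈S → ∈ᵥ-∪⁺ S _ (inj₁ y∈S)))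

    -- u has a non-neighbour in S ∪ X, which can only be w; hence w ∈ X ─ {x} and w is not adjacent to x.
    nonNbr-swappable : ∀ {X x w} → X ⊆ᵥ C → nonDeg E (S ∪ᵥ X) u ≢ 0 →
      w ∈ᵥ nonNbr E C u → x ∈ᵥ nonNbr E C w → SameSide x u × 0 < nonDeg E (S ∪ᵥ (X ─ᵥ ⁅ x ⁆ᵥ)) x
    nonNbr-swappable {X} {x} {w} X⊆C d̄u≢0 w∈N̄u x∈N̄w
      with nonDeg-witness E (S ∪ᵥ X) u d̄u≢0 | ∈-nonNbr⁻ E C {u} w∈N̄u | ∈-nonNbr⁻ E C {w} x∈N̄w
    ... | z , z∈S∪X , u≁z | w∈C , u≁w | _ , w≁x =
      NonAdj-SameSide E u≁w w≁x , nonDeg-pos E (S ∪ᵥ (X ─ᵥ ⁅ x ⁆ᵥ)) w∈S∪X─x (NonAdj-sym E w≁x)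
      where
      z≡w : z ≡ w
      z≡w = nonDeg-unique E (S ∪ᵥ C) (≤-reflexive d̄u≡1)
              (∈ᵥ-⊆ᵥ (∪ᵥ-monoʳ S X⊆C) z∈S∪X) u≁z (∈ᵥ-∪⁺ S C (inj₂ w∈C)) u≁w
      w∈X : w ∈ᵥ X
      w∈X = case ∈ᵥ-∪⁻ S X (subst (_∈ᵥ (S ∪ᵥ X)) z≡w z∈S∪X) of λ where
        (inj₁ w∈S) → contradiction w∈C (S#C w w∈S)
        (inj₂ w∈X) → w∈X
      w∈S∪X─x : w ∈ᵥ (S ∪ᵥ (X ─ᵥ ⁅ x ⁆ᵥ))
      w∈S∪X─x = ∈ᵥ-∪⁺ S _ (inj₂ (∈ᵥ-─⁺ X ⁅ x ⁆ᵥ w∈X (NonAdj⇒≢ E w≁x ∘ x∈ᵥ⁅y⁆ᵥ⇒x≡y x)))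

    P-swappable : ∀ {X x} → X ⊆ᵥ C → nonDeg E (S ∪ᵥ X) u ≢ 0 → x ∈ᵥ P →
      SameSide x u × 0 < nonDeg E (S ∪ᵥ (X ─ᵥ ⁅ x ⁆ᵥ)) x
    P-swappable {X} {x} X⊆C d̄u≢0 x∈P with nonDeg E C u ≟ℕ 1
    ... | no d̄≢1 = basePrune-swappable (subst (x ∈ᵥ_) (P-base d̄≢1) x∈P)
    ... | yes d̄≡1 with nonDeg-witness E C u (1+n≢0 ∘ trans (sym d̄≡1))
    ...   | w , w∈C , u≁w with ∈ᵥ-∪⁻ (basePrune E S C u) (nonNbr E C w)
                                 (subst (x ∈ᵥ_) (P-extended w d̄≡1 (∈-nonNbr⁺ E C w∈C u≁w)) x∈P)
    ...     | inj₁ x∈P₀ = basePrune-swappable x∈P₀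
    ...     | inj₂ x∈N̄w = nonNbr-swappable X⊆C d̄u≢0 (∈-nonNbr⁺ E C w∈C u≁w) x∈N̄w

    dominated-or-pruned : ∀ {X} → X ⊆ᵥ C → Defective E k (S ∪ᵥ X) → Dominated X ⊎ X ⊆ᵥ (C ─ᵥ (⁅ u ⁆ᵥ ∪ᵥ P))
    dominated-or-pruned {X} X⊆C defective with u ∈ᵥ? X
    ... | yes u∈X = inj₁ (X , (X⊆C , defective , u∈X) , ≤-refl)
    ... | no u∉X with nonDeg E (S ∪ᵥ X) u ≟ℕ 0
    ...   | yes d̄u≡0 = inj₁ (insert-u X⊆C defective u∉X d̄u≡0)
    ...   | no d̄u≢0 with meets-or-disjoint X P
    ...     | inj₁ (x , x∈X , x∈P) =
                let x~u , 0<d̄x = P-swappable X⊆C d̄u≢0 x∈P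
                in inj₁ (swap-for-u X⊆C defective u∉X x∈X x~u 0<d̄x)
    ...     | inj₂ X#P = inj₂ (⊆ᵥ-from-∈ᵥ X _ λ y y∈X →
                ∈ᵥ-─⁺ C (⁅ u ⁆ᵥ ∪ᵥ P) (∈ᵥ-⊆ᵥ X⊆C y∈X) λ y∈u∪P → case ∈ᵥ-∪⁻ ⁅ u ⁆ᵥ P y∈u∪P of λ where
                  (inj₁ y∈⁅u⁆) → u∉X (subst (_∈ᵥ X) (x∈ᵥ⁅y⁆ᵥ⇒x≡y u y∈⁅u⁆) y∈X)
                  (inj₂ y∈P) → X#P y y∈X y∈P)

mainTheorem8 : (m n : ℕ) (E : Adj m n) (k : ℕ) (S C : VSet m n)
    → Instance E k S C
    → (u : Vertex m n) → u ∈ᵥ C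
    → nonDeg E (S ∪ᵥ C) u ≡ 1
    → (P : VSet m n)
    → (nonDeg E C u ≢ 1 → P ≡ basePrune E S C u)
    → ((w : Vertex m n) → nonDeg E C u ≡ 1 → w ∈ᵥ nonNbr E C u
         → P ≡ (basePrune E S C u ∪ᵥ nonNbr E C w))
    → (a b c : ℕ)
    → IsMax (λ C' → C' ⊆ᵥ C × Defective E k (S ∪ᵥ C')) (λ C' → edges E (S ∪ᵥ C')) a
    → IsMax (λ C' → C' ⊆ᵥ C × Defective E k (S ∪ᵥ C') × u ∈ᵥ C')
            (λ C' → edges E (S ∪ᵥ C')) b
    → IsMax (λ C' → C' ⊆ᵥ (C ─ᵥ (⁅ u ⁆ᵥ ∪ᵥ P)) × Defective E k (S ∪ᵥ C'))
            (λ C' → edges E (S ∪ᵥ C')) c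
    → a ≡ b ⊔ c
mainTheorem8 m n E k S C (S#C , _ , _) u u∈C d̄u≡1 P P-base P-extended a b c a-max b-max c-max =
  max-split a-max b-max c-max
    (λ (X⊆C , defective , _) → X⊆C , defective)
    (λ (X⊆C─uP , defective) → ⊆ᵥ-trans X⊆C─uP (─ᵥ-⊆ᵥ C (⁅ u ⁆ᵥ ∪ᵥ P)) , defective)
    (λ (X⊆C , defective) → map₂ (_, defective) (dominated-or-pruned P P-base P-extended X⊆C defective))
  where open Pruning E k S C S#C u u∈C d̄u≡1
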